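{- Let $G$ be a finite bipartite graph with bipartition $(X,Y)$. Then $G$ is a cocomparability bigraph if and only if $\overline{G}$ has an acyclic $T$-free orientation.
   Context: $G$ is a cocomparability bigraph if there exist linear orderings $\prec_X$ of $X$ and $\prec_Y$ of $Y$ such that for all $u,v\in X$ and $w,z\in Y$, if $u\prec_X v$, $w\prec_Y z$ and $uz,vw\in E(G)$, then at least one of $uw, vz$ is in $E(G)$. Let $\overline{G}$ be the complement of $G$; $X$ and $Y$ are cliques in $\overline{G}$, and the edges of $\overline{G}$ between $X$ and $Y$ are the pairs $xy$ ($x\in X,y\in Y$) with $xy\notin E(G)$. An orientation of $\overline{G}$ is a mixed graph $\vec G$ in which every edge of $\overline{G}$ between $X$ and $Y$ stays undirected and every pair of distinct vertices both in $X$ or both in $Y$ is oriented in exactly one direction. $\vec G$ is acyclic if it has no directed cycle. $\vec G$ is $T$-free if there are no $x,x'\in X$, $y,y'\in Y$ with $xy\notin E(G)$, $x'y'\notin E(G)$, $xy'\in E(G)$, $x'y\in E(G)$, such that $\vec G$ contains both arcs $x\to x'$ and $y\to y'$. -}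

module Defs where

open import Data.Nat using (ℕ)
open import Data.Fin using (Fin)
open import Data.Bool using (Bool; true; false)
open import Data.Sum using (_⊎_; inj₁; inj₂)
open import Data.Product using (Σ; ∃; _×_; _,_)
open import Data.Empty using (⊥)
open import Relation.Nullary using (¬_)
open import Relation.Binary using (Rel; IsStrictTotalOrder)
open import Relation.Binary.PropositionalEquality using (_≡_)
open import Relation.Binary.Construct.Closure.Transitive using (TransClosure)

-- A finite bipartite graph G with bipartition (X , Y), X = Fin m, Y = Fin n.
-- Edges only go between X and Y; adj x y ≡ true  iff  xy ∈ E(G).
record Bigraph (m n : ℕ) : Set where
  field
    adj : Fin m → Fin n → Bool

module _ {m n : ℕ} (G : Bigraph m n) where
  open Bigraph G

  Edge : Fin m → Fin n → Set
  Edge x y = adj x y ≡ true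

  NonEdge : Fin m → Fin n → Set
  NonEdge x y = adj x y ≡ false

  CocompCondition : Rel (Fin m) _ → Rel (Fin n) _ → Set
  CocompCondition _≺X_ _≺Y_ =
    ∀ (u v : Fin m) (w z : Fin n) →
      u ≺X v → w ≺Y z → Edge u z → Edge v w →
      Edge u w ⊎ Edge v z

  IsCocomparabilityBigraph : Set₁
  IsCocomparabilityBigraph =
    Σ (Rel (Fin m) _) λ _≺X_ → Σ (Rel (Fin n) _) λ _≺Y_ →
      IsStrictTotalOrder _≡_ _≺X_ × IsStrictTotalOrder _≡_ _≺Y_ ×
      CocompCondition _≺X_ _≺Y_

-- An orientation of the complement of G: every pair of distinct vertices
-- on the same side is oriented in exactly one direction; the X–Y edges of
-- the complement (the non-edges of G) remain undirected.
record Orientation (m n : ℕ) : Set₁ where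
  field
    arcX : Rel (Fin m) _
    arcY : Rel (Fin n) _
    arcX-irrefl : ∀ x → ¬ arcX x x
    arcY-irrefl : ∀ y → ¬ arcY y y
    arcX-one : ∀ x x′ → ¬ x ≡ x′ → arcX x x′ ⊎ arcX x′ x
    arcY-one : ∀ y y′ → ¬ y ≡ y′ → arcY y y′ ⊎ arcY y′ y
    arcX-notboth : ∀ x x′ → arcX x x′ → arcX x′ x → ⊥
    arcY-notboth : ∀ y y′ → arcY y y′ → arcY y′ y → ⊥

module _ {m n : ℕ} (O : Orientation m n) where
  open Orientation O

  Arc : Rel (Fin m ⊎ Fin n) _
  Arc (inj₁ x) (inj₁ x′) = arcX x x′
  Arc (inj₂ y) (inj₂ y′) = arcY y y′
  Arc _ _ = ⊥

  Acyclic : Set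
  Acyclic = ∀ v → ¬ TransClosure Arc v v

module _ {m n : ℕ} (G : Bigraph m n) (O : Orientation m n) where
  open Orientation O

  TFree : Set
  TFree = ∀ (x x′ : Fin m) (y y′ : Fin n) →
    NonEdge G x y → NonEdge G x′ y′ → Edge G x y′ → Edge G x′ y →
    arcX x x′ → arcY y y′ → ⊥

HasAcyclicTFreeOrientation : {m n : ℕ} → Bigraph m n → Set₁
HasAcyclicTFreeOrientation {m} {n} G =
  Σ (Orientation m n) λ O → Acyclic O × TFree G O

-- Restricted to one side, an orientation is a tournament:
-- an irreflexive, asymmetric relation relating every two distinct vertices.
-- A tournament is a strict linear order exactly when it is transitive, and
-- (over a type with decidable equality) exactly when it has no directed
-- cycle: a cycle contradicts irreflexivity of a transitive relation, and a
-- failure of transitivity a → b → c yields the cycle a → b → c → a.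
-- Since the mixed graph has no arcs between X and Y, it is acyclic iff its
-- two sides are.  Finally, when the orders of X and Y are taken as the arcs
-- of the orientation, the cocomparability condition and T-freeness say the
-- same thing (up to contraposition, which is harmless as adjacency is a
-- Bool).  So both directions keep the same pair of relations and only
-- repackage the proofs.
module Submission where

open import Defs
open import Level using (Level; _⊔_)
open import Data.Nat using (ℕ)
open import Data.Fin using (Fin)
open import Data.Fin.Properties using (_≟_)
open import Data.Bool using (true; false)
open import Data.Product using (_×_; _,_)
open import Data.Sum using (_⊎_; inj₁; inj₂)
open import Data.Empty using (⊥; ⊥-elim)
open import Relation.Nullary using (¬_; yes; no)
open import Relation.Binary using (Rel; Transitive; Trichotomous; DecidableEquality;
  IsStrictTotalOrder; tri<; tri≈; tri>)
open import Relation.Binary.PropositionalEquality using (_≡_; refl; isEquivalence; resp₂)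
open import Relation.Binary.Construct.Closure.Transitive using (TransClosure; [_]; _∷_; transitive⁻)

record IsTournament {a ℓ : Level} {A : Set a} (R : Rel A ℓ) : Set (a ⊔ ℓ) where
  field
    irrefl    : ∀ x → ¬ R x x
    connected : ∀ x y → ¬ x ≡ y → R x y ⊎ R y x
    asym      : ∀ x y → R x y → R y x → ⊥

AcyclicRel : {a ℓ : Level} {A : Set a} → Rel A ℓ → Set (a ⊔ ℓ)
AcyclicRel {A = A} R = ∀ (x : A) → ¬ TransClosure R x x

module _ {a ℓ : Level} {A : Set a} {R : Rel A ℓ} where

  strictTotalOrder⇒tournament : IsStrictTotalOrder _≡_ R → IsTournament R
  strictTotalOrder⇒tournament sto = record
    { irrefl    = λ x → irrefl refl
    ; connected = connected
    ; asym      = λ x y → asym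
    }
    where
    open IsStrictTotalOrder sto
    connected : ∀ x y → ¬ x ≡ y → R x y ⊎ R y x
    connected x y x≢y with compare x y
    ... | tri< x<y _ _ = inj₁ x<y
    ... | tri≈ _ x≡y _ = ⊥-elim (x≢y x≡y)
    ... | tri> _ _ y<x = inj₂ y<x

  -- A strict linear order has no cycles: a cycle collapses, by
  -- transitivity, to a single step x < x.
  strictTotalOrder⇒acyclic : IsStrictTotalOrder _≡_ R → AcyclicRel R
  strictTotalOrder⇒acyclic sto x cycle =
    irrefl refl (transitive⁻ R trans cycle)
    where open IsStrictTotalOrder sto

  module _ (_≟ᴬ_ : DecidableEquality A) (T : IsTournament R) where
    open IsTournament T

    tournament⇒trichotomous : Trichotomous _≡_ R
    tournament⇒trichotomous x y with x ≟ᴬ y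
    ... | yes refl = tri≈ (irrefl x) refl (irrefl x)
    ... | no x≢y with connected x y x≢y
    ...   | inj₁ x<y = tri< x<y x≢y (asym x y x<y)
    ...   | inj₂ y<x = tri> (λ x<y → asym x y x<y y<x) x≢y y<x

    -- An acyclic tournament is transitive: if a → b → c but not a → c,
    -- then either a = c (a 2-cycle) or c → a (a 3-cycle).
    acyclic-tournament⇒transitive : AcyclicRel R → Transitive R
    acyclic-tournament⇒transitive acyclic {x} {y} {z} x<y y<z with x ≟ᴬ z
    ... | yes refl = ⊥-elim (acyclic x (x<y ∷ [ y<z ]))
    ... | no x≢z with connected x z x≢z
    ...   | inj₁ x<z = x<z
    ...   | inj₂ z<x = ⊥-elim (acyclic x (x<y ∷ y<z ∷ [ z<x ]))

    acyclic-tournament⇒strictTotalOrder : AcyclicRel R → IsStrictTotalOrder _≡_ R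
    acyclic-tournament⇒strictTotalOrder acyclic = record
      { isStrictPartialOrder = record
        { isEquivalence = isEquivalence
        ; irrefl        = λ { refl → irrefl _ }
        ; trans         = acyclic-tournament⇒transitive acyclic
        ; <-resp-≈      = resp₂ R
        }
      ; compare = tournament⇒trichotomous
      }

fromStrictTotalOrders : ∀ {m n} {_≺X_ : Rel (Fin m) _} {_≺Y_ : Rel (Fin n) _} →
  IsStrictTotalOrder _≡_ _≺X_ → IsStrictTotalOrder _≡_ _≺Y_ → Orientation m n
fromStrictTotalOrders {_≺X_ = _≺X_} {_≺Y_} sX sY = record
  { arcX = _≺X_ ; arcY = _≺Y_
  ; arcX-irrefl = irrefl TX ; arcY-irrefl = irrefl TY
  ; arcX-one = connected TX ; arcY-one = connected TY
  ; arcX-notboth = asym TX ; arcY-notboth = asym TY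
  }
  where
  open IsTournament
  TX = strictTotalOrder⇒tournament sX
  TY = strictTotalOrder⇒tournament sY

module _ {m n : ℕ} (O : Orientation m n) where
  open Orientation O

  tournamentX : IsTournament arcX
  tournamentX = record { irrefl = arcX-irrefl ; connected = arcX-one ; asym = arcX-notboth }

  tournamentY : IsTournament arcY
  tournamentY = record { irrefl = arcY-irrefl ; connected = arcY-one ; asym = arcY-notboth }

  -- There are no arcs between X and Y, so a walk between two vertices of X
  -- stays in X, and likewise for Y.
  walkX : ∀ {x x′} → TransClosure (Arc O) (inj₁ x) (inj₁ x′) → TransClosure arcX x x′
  walkX [ x→x′ ] = [ x→x′ ]
  walkX (_∷_ {y = inj₁ _} x→u u⇝x′) = x→u ∷ walkX u⇝x′
  walkX (_∷_ {y = inj₂ _} () _)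

  walkY : ∀ {y y′} → TransClosure (Arc O) (inj₂ y) (inj₂ y′) → TransClosure arcY y y′
  walkY [ y→y′ ] = [ y→y′ ]
  walkY (_∷_ {y = inj₂ _} y→u u⇝y′) = y→u ∷ walkY u⇝y′
  walkY (_∷_ {y = inj₁ _} () _)

  liftX : ∀ {x x′} → TransClosure arcX x x′ → TransClosure (Arc O) (inj₁ x) (inj₁ x′)
  liftX [ x→x′ ] = [ x→x′ ]
  liftX (x→u ∷ u⇝x′) = x→u ∷ liftX u⇝x′

  liftY : ∀ {y y′} → TransClosure arcY y y′ → TransClosure (Arc O) (inj₂ y) (inj₂ y′)
  liftY [ y→y′ ] = [ y→y′ ]
  liftY (y→u ∷ u⇝y′) = y→u ∷ liftY u⇝y′

  sides-acyclic⇒acyclic : AcyclicRel arcX → AcyclicRel arcY → Acyclic O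
  sides-acyclic⇒acyclic acX acY (inj₁ x) cycle = acX x (walkX cycle)
  sides-acyclic⇒acyclic acX acY (inj₂ y) cycle = acY y (walkY cycle)

  acyclic⇒acyclicX : Acyclic O → AcyclicRel arcX
  acyclic⇒acyclicX ac x cycle = ac (inj₁ x) (liftX cycle)

  acyclic⇒acyclicY : Acyclic O → AcyclicRel arcY
  acyclic⇒acyclicY ac y cycle = ac (inj₂ y) (liftY cycle)

edge∧nonEdge : ∀ {m n} (G : Bigraph m n) {x y} → Edge G x y → NonEdge G x y → ⊥
edge∧nonEdge G {x} {y} xy∈E xy∉E with Bigraph.adj G x y | xy∈E | xy∉E
... | .true | refl | ()

module _ {m n : ℕ} (G : Bigraph m n) (O : Orientation m n) where
  open Orientation O

  -- With the orders of X and Y taken as the arcs, the cocomparability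
  -- condition is the contrapositive of T-freeness: a forbidden T is exactly
  -- a violation of the condition.
  cocomp⇒tfree : CocompCondition G arcX arcY → TFree G O
  cocomp⇒tfree cc x x′ y y′ xy∉E x′y′∉E xy′∈E x′y∈E x→x′ y→y′
    with cc x x′ y y′ x→x′ y→y′ xy′∈E x′y∈E
  ... | inj₁ xy∈E   = edge∧nonEdge G xy∈E xy∉E
  ... | inj₂ x′y′∈E = edge∧nonEdge G x′y′∈E x′y′∉E

  -- Adjacency is Boolean, so the contrapositive can be reversed.
  tfree⇒cocomp : TFree G O → CocompCondition G arcX arcY
  tfree⇒cocomp tf u v w z u→v w→z uz∈E vw∈E with Bigraph.adj G u w in uw
  ... | true  = inj₁ refl
  ... | false with Bigraph.adj G v z in vz
  ...   | true  = inj₂ refl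
  ...   | false = ⊥-elim (tf u v w z uw vz uz∈E vw∈E u→v w→z)

proposition2p1 : ∀ {m n : ℕ} (G : Bigraph m n) →
    (IsCocomparabilityBigraph G → HasAcyclicTFreeOrientation G) ×
    (HasAcyclicTFreeOrientation G → IsCocomparabilityBigraph G)
proposition2p1 G = cocomparability⇒orientation , orientation⇒cocomparability
  where
  cocomparability⇒orientation : IsCocomparabilityBigraph G → HasAcyclicTFreeOrientation G
  cocomparability⇒orientation (_ , _ , sX , sY , cc) =
    O , sides-acyclic⇒acyclic O (strictTotalOrder⇒acyclic sX) (strictTotalOrder⇒acyclic sY) ,
    cocomp⇒tfree G O cc
    where O = fromStrictTotalOrders sX sY

  orientation⇒cocomparability : HasAcyclicTFreeOrientation G → IsCocomparabilityBigraph G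
  orientation⇒cocomparability (O , ac , tf) =
    arcX , arcY ,
    acyclic-tournament⇒strictTotalOrder _≟_ (tournamentX O) (acyclic⇒acyclicX O ac) ,
    acyclic-tournament⇒strictTotalOrder _≟_ (tournamentY O) (acyclic⇒acyclicY O ac) ,
    tfree⇒cocomp G O tf
    where open Orientation O
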